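{- Let $G$ be a simple connected graph with $n$ vertices and minimum degree at least three, and let $e$ be an edge of $G$. Suppose that the length of the longest cycle of $G$ containing $e$ is at least $n-\frac{1+\sqrt{4n-3}}{2}+1$. Then every longest cycle of $G$ containing $e$ has a chord.
   Context: A longest cycle containing $e$ is a cycle of $G$ that contains the edge $e$ and has maximum length among all cycles of $G$ containing $e$. A chord of a cycle $C$ in $G$ is an edge of $G$ joining two vertices of $C$ that are not consecutive on $C$. -}

module Defs where

open import Data.Nat using (ℕ; zero; suc; _+_; _*_; _∸_; _^_; _≤_)
open import Data.Fin using (Fin)
open import Data.List using (List; []; _∷_; length; filter; last)
open import Data.List.Relation.Unary.Unique.Propositional using (Unique)
open import Data.List.Relation.Unary.Linked using (Linked)
open import Data.List.Membership.Propositional using (_∈_)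
open import Data.Maybe using (just)
open import Data.Product using (Σ; _×_; _,_; ∃)
open import Data.Sum using (_⊎_)
open import Data.Empty using (⊥)
open import Relation.Nullary using (¬_; Dec)
open import Relation.Binary.PropositionalEquality using (_≡_)
open import Data.List using (allFin)

record SimpleGraph (n : ℕ) : Set₁ where
  field
    Adj    : Fin n → Fin n → Set
    sym    : ∀ {u v} → Adj u v → Adj v u
    irrefl : ∀ {u} → ¬ Adj u u
    adj?   : ∀ u v → Dec (Adj u v)
open SimpleGraph public

module _ {n : ℕ} (G : SimpleGraph n) where

  degree : Fin n → ℕ
  degree u = length (filter (adj? G u) (allFin n))

  data Walk : Fin n → Fin n → Set where
    [] : ∀ {u} → Walk u u
    _∷_ : ∀ {u v w} → Adj G u v → Walk v w → Walk u w

  Connected : Set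
  Connected = ∀ u v → Walk u v

  record Cycle : Set where
    field
      verts   : List (Fin n)
      long    : 3 ≤ length verts
      unique  : Unique verts
      path    : Linked (Adj G) verts
      closing : ∀ {x y xs} → verts ≡ x ∷ xs → last verts ≡ just y → Adj G y x
  open Cycle public

  cycleLength : Cycle → ℕ
  cycleLength C = length (verts C)

data Consec {n : ℕ} : List (Fin n) → Fin n → Fin n → Set where
  here  : ∀ {x y zs} → Consec (x ∷ y ∷ zs) x y
  there : ∀ {z zs x y} → Consec zs x y → Consec (z ∷ zs) x y

module _ {n : ℕ} {G : SimpleGraph n} where

  -- x y are consecutive on the cycle C (in cyclic order, either direction)
  CycleEdge : Cycle G → Fin n → Fin n → Set
  CycleEdge C x y = DirEdge x y ⊎ DirEdge y x
    where
    DirEdge : Fin n → Fin n → Set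
    DirEdge a b = Consec (verts C) a b
                  ⊎ (Σ (List (Fin n)) λ xs → verts C ≡ b ∷ xs × last (verts C) ≡ just a)

  ContainsEdge : Cycle G → Fin n → Fin n → Set
  ContainsEdge C a b = CycleEdge C a b

  LongestCycleThrough : Fin n → Fin n → Cycle G → Set
  LongestCycleThrough a b C =
    ContainsEdge C a b × (∀ (D : Cycle G) → ContainsEdge D a b → cycleLength G D ≤ cycleLength G C)

  HasChord : Cycle G → Set
  HasChord C = Σ (Fin n) λ x → Σ (Fin n) λ y →
    x ∈ verts C × y ∈ verts C × Adj G x y × ¬ CycleEdge C x y

-- L ≥ n - (1 + √(4n-3))/2 + 1, rewritten without reals:
-- since L ≤ n, t = 2(n+1-L) - 1 ≥ 1 and the condition is t ≤ √(4n-3),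
-- i.e. t² ≤ 4n - 3.
LengthBound : ℕ → ℕ → Set
LengthBound n L = (2 * (n + 1 ∸ L) ∸ 1) ^ 2 + 3 ≤ 4 * n

-- If C had no chord, every vertex x of C would have a neighbour g x off C (its degree
-- is at least 3, and only its two cycle neighbours lie on C). Cut C open at ab into an
-- a-b path P; P is a longest a-b path. For consecutive x y on P, g x ≠ g y, or g x
-- could be inserted between x and y. For consecutive pairs x y and later u v,
-- (g x , g y) ≠ (g u , g v), or x (g x) u … y (g y) v, with the stretch from y to u
-- reversed, would be a longer a-b path. So the L - 1 edges of P inject into ordered
-- pairs of distinct vertices among the r ≤ n - L vertices off C: L - 1 ≤ r(r - 1),
-- which is incompatible with (n - L)² < L, the integer form of the length bound.

module Submission where

open import Defs renaming (sym to adj-sym)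
open import Data.Nat using (ℕ; zero; suc; pred; _+_; _*_; _∸_; _^_; _≤_; _<_; z≤n; s≤s; _≤?_)
open import Data.Nat.Properties
  using ( ≤-trans; ≤-reflexive; <⇒≤; <⇒≱; ≰⇒>; n≤1+n; n<1+n; m≤n+m; n≤0⇒n≡0; <⇒≤pred; pred-mono-≤
        ; +-assoc; +-comm; +-suc; *-suc; +-mono-≤; *-mono-≤; +-cancelˡ-≤; *-cancelˡ-≤
        ; m+n∸n≡m; m∸n+n≡m; m+n≤o⇒m≤o∸n; module ≤-Reasoning)
open import Data.Nat.Solver using (module +-*-Solver)
open import Data.Fin using (Fin; _≟_)
open import Data.List using (List; []; _∷_; [_]; _++_; _ʳ++_; length; filter; head; last; map; concatMap; allFin)
open import Data.List.Properties using (++-assoc; length-++; length-map; length-tabulate; filter-notAll; ∷-injectiveˡ)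
open import Data.List.Membership.Propositional using (_∈_; _∉_)
open import Data.List.Membership.Propositional.Properties
  using (∈-++⁺ˡ; ∈-++⁺ʳ; ∈-map⁺; ∈-map⁻; ∈-filter⁺; ∈-filter⁻; ∈-concatMap⁺; ∈-allFin)
open import Data.List.Relation.Binary.Subset.Propositional using (_⊆_)
open import Data.List.Relation.Binary.Permutation.Propositional
  using (_↭_; refl; prep; swap; ↭-sym; ↭-trans; ↭-reflexive; ↭⇒↭ₛ; module PermutationReasoning)
open import Data.List.Relation.Binary.Permutation.Propositional.Properties
  using (shift; ++⁺ˡ; ++↭ʳ++; ↭-length; ∈-resp-↭; All-resp-↭)
  renaming (++-comm to ↭-++-comm)
import Data.List.Relation.Binary.Permutation.Setoid.Properties as PermutationₛProperties
open import Data.List.Relation.Unary.All as All using (All; []; _∷_)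
open import Data.List.Relation.Unary.All.Properties using (¬Any⇒All¬)
open import Data.List.Relation.Unary.Any as Any using (here; there)
open import Data.List.Relation.Unary.Linked as Linked using (Linked; []; [-]; _∷_; _∷′_)
import Data.List.Relation.Unary.Linked.Properties as Linkedₚ
open import Data.List.Relation.Unary.AllPairs using ([]; _∷_)
open import Data.List.Relation.Unary.Unique.Propositional using (Unique)
open import Data.List.Relation.Unary.Unique.Propositional.Properties using (filter⁺; allFin⁺)
  renaming (++⁺ to Unique-++⁺)
open import Data.Maybe using (just; nothing)
open import Data.Maybe.Properties using (just-injective) renaming (≡-dec to Maybe-≟)
open import Data.Maybe.Relation.Binary.Connected using (just; nothing; nothing-just) renaming (Connected to MaybeConnected)
open import Data.Product as Product using (Σ; ∃; ∃₂; _×_; _,_; proj₁; proj₂)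
open import Data.Product.Properties using () renaming (≡-dec to ×-≟)
open import Data.Sum using (_⊎_; inj₁; inj₂)
import Data.Sum.Effectful.Left as SumLeft
open import Data.Empty using (⊥; ⊥-elim)
open import Function using (_∘_)
open import Level using (0ℓ)
open import Relation.Binary.Core using (Rel)
open import Relation.Binary.Definitions using (DecidableEquality; Symmetric)
open import Relation.Binary.PropositionalEquality
  using (_≡_; _≢_; refl; sym; trans; cong; subst; subst₂; setoid; module ≡-Reasoning)
open import Relation.Nullary using (¬_; Dec; yes; no; ¬?; contradiction)
open import Relation.Nullary.Decidable using (_⊎-dec_)

_∈?_ : ∀ {n} (v : Fin n) xs → Dec (v ∈ xs)
v ∈? xs = Any.any? (v ≟_) xs

module _ {A : Set} where

  head-++-∷ : ∀ (xs : List A) {x ys zs} → head (xs ++ x ∷ ys) ≡ head (xs ++ x ∷ zs)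
  head-++-∷ []      = refl
  head-++-∷ (_ ∷ _) = refl

  head-++ : ∀ (xs : List A) {ys y} → head xs ≡ just y → head (xs ++ ys) ≡ just y
  head-++ (_ ∷ _) eq = eq

  head-ʳ++ : ∀ (xs : List A) {ys u} → last xs ≡ just u → head (xs ʳ++ ys) ≡ just u
  head-ʳ++ (_ ∷ [])     refl = refl
  head-ʳ++ (_ ∷ y ∷ xs) eq   = head-ʳ++ (y ∷ xs) eq

  last-++-∷ : ∀ (xs : List A) {y ys} → last (xs ++ y ∷ ys) ≡ last (y ∷ ys)
  last-++-∷ []           = refl
  last-++-∷ (_ ∷ [])     = refl
  last-++-∷ (_ ∷ x ∷ xs) = last-++-∷ (x ∷ xs)

  last-++ : ∀ (xs : List A) {ys u} → last ys ≡ just u → last (xs ++ ys) ≡ just u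
  last-++ xs {_ ∷ _} eq = trans (last-++-∷ xs) eq

  last-∷-ʳ++ : ∀ (xs : List A) {x y ys} → last (x ∷ xs ʳ++ y ∷ ys) ≡ last (y ∷ ys)
  last-∷-ʳ++ []       = refl
  last-∷-ʳ++ (z ∷ xs) {x} {y} {ys} = last-∷-ʳ++ xs {x} {z} {y ∷ ys}

  last⇒∈ : ∀ {xs : List A} {x} → last xs ≡ just x → x ∈ xs
  last⇒∈ {_ ∷ []}     refl = here refl
  last⇒∈ {_ ∷ y ∷ xs} eq   = there (last⇒∈ {y ∷ xs} eq)

  Unique-resp-↭ : ∀ {xs ys : List A} → xs ↭ ys → Unique xs → Unique ys
  Unique-resp-↭ p = PermutationₛProperties.Unique-resp-↭ (setoid A) (↭⇒↭ₛ p)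

  Unique-⊆⇒length≤ : DecidableEquality A → ∀ {xs ys : List A} → Unique xs → xs ⊆ ys → length xs ≤ length ys
  Unique-⊆⇒length≤ _≟ₐ_ {[]}     _            _     = z≤n
  Unique-⊆⇒length≤ _≟ₐ_ {x ∷ xs} {ys} (x∉xs ∷ xs!) x∷xs⊆ys =
    ≤-trans (s≤s (Unique-⊆⇒length≤ _≟ₐ_ xs! xs⊆others)) (filter-notAll other? ys x∈others)
    where
    other? = λ y → ¬? (y ≟ₐ x)
    xs⊆others : xs ⊆ filter other? ys
    xs⊆others y∈xs = ∈-filter⁺ other? (x∷xs⊆ys (there y∈xs)) (λ y≡x → All.lookup x∉xs y∈xs (sym y≡x))
    x∈others = Any.map (λ x≡y y≢x → y≢x (sym x≡y)) (x∷xs⊆ys (here refl))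

  shift-after : ∀ (xs : List A) {x} y {ys} → xs ++ x ∷ y ∷ ys ↭ y ∷ xs ++ x ∷ ys
  shift-after xs {x} y {ys} = ↭-trans (++⁺ˡ xs (swap x y refl)) (shift y xs (x ∷ ys))

  reroute-↭ : ∀ (xs : List A) {x} w S z {ys} → xs ++ x ∷ w ∷ S ʳ++ z ∷ ys ↭ w ∷ z ∷ xs ++ x ∷ S ++ ys
  reroute-↭ xs {x} w S z {ys} = begin
    xs ++ x ∷ w ∷ S ʳ++ z ∷ ys     ↭⟨ shift-after xs w ⟩
    w ∷ xs ++ x ∷ S ʳ++ z ∷ ys     ↭⟨ prep w (++⁺ˡ xs (prep x (↭-sym (++↭ʳ++ S (z ∷ ys))))) ⟩
    w ∷ xs ++ x ∷ S ++ z ∷ ys      ≡⟨ cong (w ∷_) (sym (++-assoc xs (x ∷ S) (z ∷ ys))) ⟩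
    w ∷ (xs ++ x ∷ S) ++ z ∷ ys    ↭⟨ prep w (shift z (xs ++ x ∷ S) ys) ⟩
    w ∷ z ∷ (xs ++ x ∷ S) ++ ys    ≡⟨ cong (λ zs → w ∷ z ∷ zs) (++-assoc xs (x ∷ S) ys) ⟩
    w ∷ z ∷ xs ++ x ∷ S ++ ys      ∎
    where open PermutationReasoning

module _ {A : Set} {R : Rel A 0ℓ} where

  Linked-++⁻ˡ : ∀ xs {ys} → Linked R (xs ++ ys) → Linked R xs
  Linked-++⁻ˡ []           _        = []
  Linked-++⁻ˡ (_ ∷ [])     _        = [-]
  Linked-++⁻ˡ (_ ∷ _ ∷ xs) (r ∷ rs) = r ∷ Linked-++⁻ˡ (_ ∷ xs) rs

  Linked-++⁻ʳ : ∀ xs {ys} → Linked R (xs ++ ys) → Linked R ys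
  Linked-++⁻ʳ []       rs = rs
  Linked-++⁻ʳ (_ ∷ xs) rs = Linked-++⁻ʳ xs (Linked.tail rs)

  Linked-replaceSuffix : ∀ xs {x ys zs} → Linked R (xs ++ x ∷ ys) → Linked R (x ∷ zs) → Linked R (xs ++ x ∷ zs)
  Linked-replaceSuffix []           _        rs = rs
  Linked-replaceSuffix (_ ∷ [])     (r ∷ _)  rs = r ∷ rs
  Linked-replaceSuffix (_ ∷ y ∷ xs) (r ∷ ls) rs = r ∷ Linked-replaceSuffix (y ∷ xs) ls rs

  Linked-ʳ++⁺ : Symmetric R → ∀ {x} xs {ys} → Linked R (x ∷ xs) → Linked R (x ∷ ys) → Linked R (xs ʳ++ x ∷ ys)
  Linked-ʳ++⁺ R-sym []       _        x∷ys = x∷ys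
  Linked-ʳ++⁺ R-sym (_ ∷ xs) (r ∷ rs) x∷ys = Linked-ʳ++⁺ R-sym xs rs (R-sym r ∷ x∷ys)

  Linked-rotate : ∀ xs x {y ys} → Linked R (xs ++ x ∷ y ∷ ys) →
                  MaybeConnected R (last (xs ++ x ∷ y ∷ ys)) (head (xs ++ x ∷ y ∷ ys)) →
                  Linked R (y ∷ ys ++ xs ++ [ x ])
  Linked-rotate xs x {y} {ys} rs closed =
    Linkedₚ.++⁺ (Linked-++⁻ʳ (xs ++ [ x ]) rs′) closed′ (Linked-++⁻ˡ (xs ++ [ x ]) rs′)
    where
    rs′ = subst (Linked R) (sym (++-assoc xs [ x ] (y ∷ ys))) rs
    closed′ = subst₂ (MaybeConnected R) (last-++-∷ xs) (head-++-∷ xs) closed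

module _ {A : Set} where

  consecutivePairs : List A → List (A × A)
  consecutivePairs (x ∷ y ∷ xs) = (x , y) ∷ consecutivePairs (y ∷ xs)
  consecutivePairs _            = []

  length-consecutivePairs : ∀ xs → length (consecutivePairs xs) ≡ pred (length xs)
  length-consecutivePairs []           = refl
  length-consecutivePairs (_ ∷ [])     = refl
  length-consecutivePairs (_ ∷ y ∷ xs) = cong suc (length-consecutivePairs (y ∷ xs))

  ∈-consecutivePairs⁻ : ∀ xs {x y} → (x , y) ∈ consecutivePairs xs → ∃₂ λ ys zs → xs ≡ ys ++ x ∷ y ∷ zs
  ∈-consecutivePairs⁻ (_ ∷ _ ∷ xs) (here refl) = [] , xs , refl
  ∈-consecutivePairs⁻ (x ∷ y ∷ xs) (there p) =
    let ys , zs , eq = ∈-consecutivePairs⁻ (y ∷ xs) p in x ∷ ys , zs , cong (x ∷_) eq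

  -- Two consecutive pairs (x , y) and (u , v), the first occurring earlier, enclose a
  -- nonempty segment S running from y to u.
  Unique-map-consecutivePairs : ∀ {B : Set} (f : A × A → B) xs →
    (∀ ys x S v zs {y u} → xs ≡ ys ++ x ∷ S ++ v ∷ zs → head S ≡ just y → last S ≡ just u →
       f (x , y) ≢ f (u , v)) →
    Unique (map f (consecutivePairs xs))
  Unique-map-consecutivePairs f []           _        = []
  Unique-map-consecutivePairs f (_ ∷ [])     _        = []
  Unique-map-consecutivePairs f (x ∷ y ∷ xs) distinct =
    later [ y ] xs refl refl refl
    ∷ Unique-map-consecutivePairs f (y ∷ xs) (λ ys x′ S v zs eq → distinct (x ∷ ys) x′ S v zs (cong (x ∷_) eq))
    where
    later : ∀ S {u} ws → head S ≡ just y → last S ≡ just u → y ∷ xs ≡ S ++ ws →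
            All (f (x , y) ≢_) (map f (consecutivePairs (u ∷ ws)))
    later S []       _     _     _  = []
    later S (v ∷ ws) headS lastS eq =
      distinct [] x S v ws (cong (x ∷_) eq) headS lastS
      ∷ later (S ++ [ v ]) ws (head-++ S headS) (last-++-∷ S) (trans eq (sym (++-assoc S [ v ] ws)))

module _ {A : Set} (_≟ₐ_ : DecidableEquality A) where

  partners : List A → A → List (A × A)
  partners xs x = map (x ,_) (filter (λ y → ¬? (y ≟ₐ x)) xs)

  distinctPairs : List A → List (A × A)
  distinctPairs xs = concatMap (partners xs) xs

  ∈-distinctPairs⁺ : ∀ {xs x y} → x ∈ xs → y ∈ xs → x ≢ y → (x , y) ∈ distinctPairs xs
  ∈-distinctPairs⁺ {xs} x∈ y∈ x≢y =
    ∈-concatMap⁺ (partners xs)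
      (Any.map (λ { refl → ∈-map⁺ (_ ,_) (∈-filter⁺ (λ z → ¬? (z ≟ₐ _)) y∈ (x≢y ∘ sym)) }) x∈)

  length-distinctPairs : ∀ xs → length (distinctPairs xs) ≤ length xs * pred (length xs)
  length-distinctPairs xs = rows≤ xs (λ x∈ → x∈)
    where
    row≤ : ∀ {x} → x ∈ xs → length (partners xs x) ≤ pred (length xs)
    row≤ {x} x∈ = subst (_≤ pred (length xs)) (sym (length-map (x ,_) (filter (λ y → ¬? (y ≟ₐ x)) xs)))
      (<⇒≤pred (filter-notAll (λ y → ¬? (y ≟ₐ x)) xs (Any.map (λ x≡y y≢x → y≢x (sym x≡y)) x∈)))
    rows≤ : ∀ ws → ws ⊆ xs → length (concatMap (partners xs) ws) ≤ length ws * pred (length xs)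
    rows≤ []       _   = z≤n
    rows≤ (w ∷ ws) ws⊆ = begin
      length (partners xs w ++ concatMap (partners xs) ws)
        ≡⟨ length-++ (partners xs w) ⟩
      length (partners xs w) + length (concatMap (partners xs) ws)
        ≤⟨ +-mono-≤ (row≤ (ws⊆ (here refl))) (rows≤ ws (ws⊆ ∘ there)) ⟩
      pred (length xs) + length ws * pred (length xs)
        ∎
      where open ≤-Reasoning

  consecutiveImages-bound : ∀ {B : Set} (f : B → A) xs ys →
    (∀ {x} → x ∈ xs → f x ∈ ys) →
    (∀ zs x y ws → xs ≡ zs ++ x ∷ y ∷ ws → f x ≢ f y) →
    (∀ zs x S v ws {y u} → xs ≡ zs ++ x ∷ S ++ v ∷ ws → head S ≡ just y → last S ≡ just u →
       (f x , f y) ≢ (f u , f v)) →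
    pred (length xs) ≤ length ys * pred (length ys)
  consecutiveImages-bound f xs ys f∈ys adjacent-distinct pairs-distinct = begin
    pred (length xs)                      ≡⟨ length-consecutivePairs xs ⟨
    length (consecutivePairs xs)          ≡⟨ length-map f² (consecutivePairs xs) ⟨
    length (map f² (consecutivePairs xs)) ≤⟨ Unique-⊆⇒length≤ (×-≟ _≟ₐ_ _≟ₐ_) images-unique images⊆ ⟩
    length (distinctPairs ys)             ≤⟨ length-distinctPairs ys ⟩
    length ys * pred (length ys)          ∎
    where
    open ≤-Reasoning
    f² = Product.map f f
    images-unique = Unique-map-consecutivePairs f² xs pairs-distinct
    images⊆ : map f² (consecutivePairs xs) ⊆ distinctPairs ys
    images⊆ p∈ with ∈-map⁻ f² p∈
    ... | (x , y) , xy∈ , refl with ∈-consecutivePairs⁻ xs xy∈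
    ...   | zs , ws , refl = ∈-distinctPairs⁺ (f∈ys (∈-++⁺ʳ zs (here refl))) (f∈ys (∈-++⁺ʳ zs (there (here refl))))
                               (adjacent-distinct zs x y ws refl)

LengthBound⇒square< : ∀ K L → LengthBound (K + L) L → K * K < L
LengthBound⇒square< K L bound = +-cancelˡ-≤ K _ _ (*-cancelˡ-≤ 4 (begin
  4 * (K + suc (K * K))               ≡⟨ square-identity ⟨
  suc (2 * K) ^ 2 + 3                 ≡⟨ cong (λ m → (m ∸ 1) ^ 2 + 3) gap ⟨
  (2 * (K + L + 1 ∸ L) ∸ 1) ^ 2 + 3   ≤⟨ bound ⟩
  4 * (K + L)                         ∎))
  where
  open ≤-Reasoning
  open +-*-Solver
  square-identity : suc (2 * K) ^ 2 + 3 ≡ 4 * (K + suc (K * K))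
  square-identity = solve 1 (λ k → (con 1 :+ con 2 :* k) :^ 2 :+ con 3 := con 4 :* (k :+ (con 1 :+ k :* k))) refl K
  gap : 2 * (K + L + 1 ∸ L) ≡ 2 + 2 * K
  gap = trans (cong (λ m → 2 * (m ∸ L)) (trans (+-assoc K L 1) (trans (cong (K +_) (+-comm L 1)) (+-suc K L))))
              (trans (cong (2 *_) (m+n∸n≡m (suc K) L)) (*-suc 2 K))

-- With K = n - L, the bound reads K² < L, i.e. K² ≤ L - 1 ≤ r(r - 1) ≤ K(K - 1);
-- this forces K = 0, and then L - 1 ≤ 0.
¬LengthBound : ∀ {n L r} → 2 ≤ L → r + L ≤ n → pred L ≤ r * pred r → ¬ LengthBound n L
¬LengthBound {n} {L} {r} 2≤L r+L≤n pairs bound = impossible K r≤K (<⇒≤pred K*K<L)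
  where
  K = n ∸ L
  r≤K = m+n≤o⇒m≤o∸n r r+L≤n
  K*K<L = LengthBound⇒square< K L (subst (λ m → LengthBound m L) (sym (m∸n+n≡m (≤-trans (m≤n+m L r) r+L≤n))) bound)
  impossible : ∀ m → r ≤ m → m * m ≤ pred L → ⊥
  impossible zero    r≤0 _      = <⇒≱ (<⇒≤pred 2≤L) (subst (λ m → pred L ≤ m * pred m) (n≤0⇒n≡0 r≤0) pairs)
  impossible (suc m) r≤m square =
    <⇒≱ (n<1+n m) (*-cancelˡ-≤ (suc m) (≤-trans square (≤-trans pairs (*-mono-≤ r≤m (pred-mono-≤ r≤m)))))

module _ {n : ℕ} where

  Consec-∈ˡ : ∀ {xs : List (Fin n)} {x y} → Consec xs x y → x ∈ xs
  Consec-∈ˡ here      = here refl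
  Consec-∈ˡ (there c) = there (Consec-∈ˡ c)

  Consec-∈ʳ-tail : ∀ {z} {xs : List (Fin n)} {x y} → Consec (z ∷ xs) x y → y ∈ xs
  Consec-∈ʳ-tail here                   = here refl
  Consec-∈ʳ-tail (there {zs = _ ∷ _} c) = there (Consec-∈ʳ-tail c)

  Consec⇒++ : ∀ {xs : List (Fin n)} {x y} → Consec xs x y → ∃₂ λ ys zs → xs ≡ ys ++ x ∷ y ∷ zs
  Consec⇒++ {_ ∷ _ ∷ zs} here = [] , zs , refl
  Consec⇒++ {z ∷ _} (there c) = let ys , zs , eq = Consec⇒++ c in z ∷ ys , zs , cong (z ∷_) eq

  Consec-functional : ∀ {xs : List (Fin n)} {x y y′} → Unique xs → Consec xs x y → Consec xs x y′ → y ≡ y′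
  Consec-functional _         here      here       = refl
  Consec-functional (x∉ ∷ _)  here      (there c)  = contradiction refl (All.lookup x∉ (Consec-∈ˡ c))
  Consec-functional (x∉ ∷ _)  (there c) here       = contradiction refl (All.lookup x∉ (Consec-∈ˡ c))
  Consec-functional (_ ∷ xs!) (there c) (there c′) = Consec-functional xs! c c′

  Consec-injective : ∀ {xs : List (Fin n)} {x x′ y} → Unique xs → Consec xs x y → Consec xs x′ y → x ≡ x′
  Consec-injective _            here      here       = refl
  Consec-injective (_ ∷ y∉ ∷ _) here      (there c)  = contradiction refl (All.lookup y∉ (Consec-∈ʳ-tail c))
  Consec-injective (_ ∷ y∉ ∷ _) (there c) here       = contradiction refl (All.lookup y∉ (Consec-∈ʳ-tail c))
  Consec-injective (_ ∷ xs!)    (there c) (there c′) = Consec-injective xs! c c′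

  Consec-¬last : ∀ {xs : List (Fin n)} {x y} → Unique xs → Consec xs x y → last xs ≢ just x
  Consec-¬last (x∉ ∷ _) here                      eq = contradiction refl (All.lookup x∉ (last⇒∈ eq))
  Consec-¬last (_ ∷ xs!) (there {zs = _ ∷ _} c) eq = Consec-¬last xs! c eq

  Consec-¬head : ∀ {x : Fin n} {xs y} → Unique (x ∷ xs) → ¬ Consec (x ∷ xs) y x
  Consec-¬head (x∉ ∷ _) c = contradiction refl (All.lookup x∉ (Consec-∈ʳ-tail c))

  Consec? : ∀ (xs : List (Fin n)) x y → Dec (Consec xs x y)
  Consec? []           x y = no λ ()
  Consec? (_ ∷ [])     x y = no λ { (there ()) }
  Consec? (z ∷ w ∷ zs) x y with Consec? (w ∷ zs) x y | z ≟ x | w ≟ y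
  ... | yes c | _        | _        = yes (there c)
  ... | no ¬c | yes refl | yes refl = yes here
  ... | no ¬c | no z≢x   | _        = no λ { here → z≢x refl ; (there c) → ¬c c }
  ... | no ¬c | yes _    | no w≢y   = no λ { here → w≢y refl ; (there c) → ¬c c }

  -- y follows x on the cycle through xs, possibly across the closing edge;
  -- CycleEdge C x y unfolds to CycleSucc (verts C) x y ⊎ CycleSucc (verts C) y x.
  CycleSucc : List (Fin n) → Fin n → Fin n → Set
  CycleSucc xs x y = Consec xs x y ⊎ Σ (List (Fin n)) λ ys → xs ≡ y ∷ ys × last xs ≡ just x

  CycleSucc? : ∀ xs x y → Dec (CycleSucc xs x y)
  CycleSucc? xs x y = Consec? xs x y ⊎-dec closing? xs
    where
    closing? : ∀ xs → Dec (Σ (List (Fin n)) λ ys → xs ≡ y ∷ ys × last xs ≡ just x)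
    closing? []       = no λ { (_ , () , _) }
    closing? (z ∷ zs) with z ≟ y | Maybe-≟ _≟_ (last (z ∷ zs)) (just x)
    ... | yes refl | yes eq  = yes (zs , refl , eq)
    ... | no z≢y   | _       = no λ { (_ , refl , _) → z≢y refl }
    ... | yes _    | no ¬eq  = no λ { (_ , refl , eq) → ¬eq eq }

  CycleSucc-functional : ∀ {xs x y y′} → Unique xs → CycleSucc xs x y → CycleSucc xs x y′ → y ≡ y′
  CycleSucc-functional xs! (inj₁ c)                (inj₁ c′)               = Consec-functional xs! c c′
  CycleSucc-functional xs! (inj₁ c)                (inj₂ (_ , _ , eq))     = contradiction eq (Consec-¬last xs! c)
  CycleSucc-functional xs! (inj₂ (_ , _ , eq))     (inj₁ c)                = contradiction eq (Consec-¬last xs! c)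
  CycleSucc-functional xs! (inj₂ (_ , refl , _))   (inj₂ (_ , refl , _))   = refl

  CycleSucc-injective : ∀ {xs x x′ y} → Unique xs → CycleSucc xs x y → CycleSucc xs x′ y → x ≡ x′
  CycleSucc-injective xs! (inj₁ c)              (inj₁ c′)             = Consec-injective xs! c c′
  CycleSucc-injective xs! (inj₁ c)              (inj₂ (_ , refl , _)) = contradiction c (Consec-¬head xs!)
  CycleSucc-injective xs! (inj₂ (_ , refl , _)) (inj₁ c)              = contradiction c (Consec-¬head xs!)
  CycleSucc-injective xs! (inj₂ (_ , _ , eq))   (inj₂ (_ , _ , eq′))  = just-injective (trans (sym eq) eq′)

  CycleAdjacent : List (Fin n) → Fin n → Fin n → Set
  CycleAdjacent xs x y = CycleSucc xs x y ⊎ CycleSucc xs y x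

  -- Each of the three would be the successor or the predecessor of v, so two coincide.
  atMostTwoCycleNeighbours : ∀ {xs v y₁ y₂ y₃} → Unique xs → y₁ ≢ y₂ → y₁ ≢ y₃ → y₂ ≢ y₃ →
    CycleAdjacent xs v y₁ → CycleAdjacent xs v y₂ → CycleAdjacent xs v y₃ → ⊥
  atMostTwoCycleNeighbours xs! y₁≢y₂ _ _ (inj₁ s₁) (inj₁ s₂) _ = y₁≢y₂ (CycleSucc-functional xs! s₁ s₂)
  atMostTwoCycleNeighbours xs! y₁≢y₂ _ _ (inj₂ p₁) (inj₂ p₂) _ = y₁≢y₂ (CycleSucc-injective xs! p₁ p₂)
  atMostTwoCycleNeighbours xs! _ y₁≢y₃ _ (inj₁ s₁) _ (inj₁ s₃) = y₁≢y₃ (CycleSucc-functional xs! s₁ s₃)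
  atMostTwoCycleNeighbours xs! _ y₁≢y₃ _ (inj₂ p₁) _ (inj₂ p₃) = y₁≢y₃ (CycleSucc-injective xs! p₁ p₃)
  atMostTwoCycleNeighbours xs! _ _ y₂≢y₃ _ (inj₁ s₂) (inj₁ s₃) = y₂≢y₃ (CycleSucc-functional xs! s₂ s₃)
  atMostTwoCycleNeighbours xs! _ _ y₂≢y₃ _ (inj₂ p₂) (inj₂ p₃) = y₂≢y₃ (CycleSucc-injective xs! p₂ p₃)

  outside : List (Fin n) → List (Fin n)
  outside xs = filter (λ v → ¬? (v ∈? xs)) (allFin n)

  ∈-outside⁺ : ∀ {xs v} → v ∉ xs → v ∈ outside xs
  ∈-outside⁺ {xs} {v} v∉ = ∈-filter⁺ (λ v → ¬? (v ∈? xs)) (∈-allFin v) v∉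

  length-outside : ∀ {xs} → Unique xs → length (outside xs) + length xs ≤ n
  length-outside {xs} xs! = subst₂ _≤_ (length-++ (outside xs)) (length-tabulate (λ i → i))
    (Unique-⊆⇒length≤ _≟_ (Unique-++⁺ (filter⁺ _ (allFin⁺ n)) xs! disjoint) (λ {v} _ → ∈-allFin v))
    where
    disjoint : ∀ {v} → ¬ (v ∈ outside xs × v ∈ xs)
    disjoint (v∈out , v∈xs) = proj₂ (∈-filter⁻ (λ v → ¬? (v ∈? xs)) {xs = allFin n} v∈out) v∈xs

OutsideNeighbour : ∀ {n} → SimpleGraph n → List (Fin n) → Fin n → Set
OutsideNeighbour G xs v = ∃ λ w → Adj G v w × w ∉ xs

All-choice : ∀ {n} {Q : Fin n → Fin n → Set} {xs} → All (λ x → ∃ (Q x)) xs →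
             Σ (Fin n → Fin n) λ f → ∀ {x} → x ∈ xs → Q x (f x)
All-choice {n} {Q} {xs} witnesses = (λ x → pick x (x ∈? xs)) , λ {x} x∈ → pick-spec x∈ (x ∈? xs)
  where
  pick : ∀ x → Dec (x ∈ xs) → Fin n
  pick x (yes x∈) = proj₁ (All.lookup witnesses x∈)
  pick x (no _)   = x
  pick-spec : ∀ {x} → x ∈ xs → (x∈? : Dec (x ∈ xs)) → Q x (pick x x∈?)
  pick-spec _  (yes x∈) = proj₂ (All.lookup witnesses x∈)
  pick-spec x∈ (no x∉)  = contradiction x∈ x∉

Cycle-closed : ∀ {n} {G : SimpleGraph n} (C : Cycle G) → MaybeConnected (Adj G) (last (verts C)) (head (verts C))
Cycle-closed {G = G} C = closed (verts C) refl
  where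
  closed : ∀ xs → verts C ≡ xs → MaybeConnected (Adj G) (last xs) (head xs)
  closed []       _  = nothing
  closed (x ∷ xs) eq with last (x ∷ xs) in lastEq
  ... | just y  = just (closing C eq (trans (cong last eq) lastEq))
  ... | nothing = nothing-just

module Chords {n : ℕ} {G : SimpleGraph n} (C : Cycle G) where

  neighbourKind : ∀ {v y} → v ∈ verts C → Adj G v y →
                  (HasChord C ⊎ OutsideNeighbour G (verts C) v) ⊎ CycleEdge C v y
  neighbourKind {v} {y} v∈ vy with y ∈? verts C
  ... | no y∉ = inj₁ (inj₂ (y , vy , y∉))
  ... | yes y∈ with CycleSucc? (verts C) v y ⊎-dec CycleSucc? (verts C) y v
  ...   | yes edge = inj₂ edge
  ...   | no ¬edge = inj₁ (inj₁ (v , y , v∈ , y∈ , vy , ¬edge))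

  chordOrOutsideNeighbour : ∀ {v} → v ∈ verts C → 3 ≤ degree G v → HasChord C ⊎ OutsideNeighbour G (verts C) v
  chordOrOutsideNeighbour {v} v∈ deg =
    among (filter (adj? G v) (allFin n)) deg (filter⁺ (adj? G v) (allFin⁺ n))
          (λ y∈ → proj₂ (∈-filter⁻ (adj? G v) {xs = allFin n} y∈))
    where
    among : ∀ ys → 3 ≤ length ys → Unique ys → (∀ {y} → y ∈ ys → Adj G v y) →
            HasChord C ⊎ OutsideNeighbour G (verts C) v
    among []              ()
    among (_ ∷ [])         (s≤s ())
    among (_ ∷ _ ∷ [])     (s≤s (s≤s ()))
    among (y₁ ∷ y₂ ∷ y₃ ∷ _) _ ((y₁≢y₂ ∷ y₁≢y₃ ∷ _) ∷ (y₂≢y₃ ∷ _) ∷ _) adj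
      with neighbourKind v∈ (adj (here refl)) | neighbourKind v∈ (adj (there (here refl)))
         | neighbourKind v∈ (adj (there (there (here refl))))
    ... | inj₁ found | _          | _          = found
    ... | _          | inj₁ found | _          = found
    ... | _          | _          | inj₁ found = found
    ... | inj₂ e₁    | inj₂ e₂    | inj₂ e₃    =
      ⊥-elim (atMostTwoCycleNeighbours (unique C) y₁≢y₂ y₁≢y₃ y₂≢y₃ e₁ e₂ e₃)

  chordOrOutsideNeighbours : (∀ v → 3 ≤ degree G v) → HasChord C ⊎ All (OutsideNeighbour G (verts C)) (verts C)
  chordOrOutsideNeighbours deg =
    All.mapA 0ℓ (SumLeft.applicative (HasChord C) 0ℓ) (λ v∈ → chordOrOutsideNeighbour v∈ (deg _))
      (All.tabulate (λ v∈ → v∈))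

module ABPaths {n : ℕ} (G : SimpleGraph n) (a b : Fin n) where

  Endpoints : List (Fin n) → Set
  Endpoints P = (head P ≡ just a × last P ≡ just b) ⊎ (head P ≡ just b × last P ≡ just a)

  record IsABPath (P : List (Fin n)) : Set where
    field
      distinct  : Unique P
      linked    : Linked (Adj G) P
      endpoints : Endpoints P
  open IsABPath

  LongestABPath : List (Fin n) → Set
  LongestABPath P = IsABPath P × ∀ {Q} → IsABPath Q → length Q ≤ length P

  Endpoints-resp : ∀ {P Q} → head Q ≡ head P → last Q ≡ last P → Endpoints P → Endpoints Q
  Endpoints-resp h≡ l≡ (inj₁ (ha , lb)) = inj₁ (trans h≡ ha , trans l≡ lb)
  Endpoints-resp h≡ l≡ (inj₂ (hb , la)) = inj₂ (trans h≡ hb , trans l≡ la)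

  ABPath⇒Cycle : Adj G a b → ∀ {P} → IsABPath P → 3 ≤ length P →
                 Σ (Cycle G) λ D → cycleLength G D ≡ length P × ContainsEdge D a b
  ABPath⇒Cycle ab {x ∷ T} path 3≤ = D , refl , contains (endpoints path)
    where
    closing′ : Endpoints (x ∷ T) → ∀ {x′ y xs} → x ∷ T ≡ x′ ∷ xs → last (x ∷ T) ≡ just y → Adj G y x′
    closing′ (inj₁ (ha , lb)) eq ly =
      subst₂ (Adj G) (just-injective (trans (sym lb) ly)) (trans (sym (just-injective ha)) (∷-injectiveˡ eq)) (adj-sym G ab)
    closing′ (inj₂ (hb , la)) eq ly =
      subst₂ (Adj G) (just-injective (trans (sym la) ly)) (trans (sym (just-injective hb)) (∷-injectiveˡ eq)) ab
    D : Cycle G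
    D = record { verts = x ∷ T ; long = 3≤ ; unique = distinct path ; path = linked path
               ; closing = closing′ (endpoints path) }
    contains : Endpoints (x ∷ T) → ContainsEdge D a b
    contains (inj₁ (ha , lb)) = inj₂ (inj₂ (T , cong (_∷ T) (just-injective ha) , lb))
    contains (inj₂ (hb , la)) = inj₁ (inj₂ (T , cong (_∷ T) (just-injective hb) , la))

  Cycle-asABPath : (C : Cycle G) → Endpoints (verts C) → IsABPath (verts C)
  Cycle-asABPath C ends = record { distinct = unique C ; linked = path C ; endpoints = ends }

  Cycle-rotate : (C : Cycle G) → ∀ {x y} → Consec (verts C) x y → Endpoints (y ∷ [ x ]) →
                 Σ (List (Fin n)) λ P → IsABPath P × P ↭ verts C
  Cycle-rotate C {x} {y} c ends with Consec⇒++ c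
  ... | A , D , eq = y ∷ D ++ A ++ [ x ] , rotated , rotated↭
    where
    rotated↭ : y ∷ D ++ A ++ [ x ] ↭ verts C
    rotated↭ = ↭-trans (↭-++-comm (y ∷ D) (A ++ [ x ])) (↭-reflexive (trans (++-assoc A [ x ] (y ∷ D)) (sym eq)))
    rotated : IsABPath (y ∷ D ++ A ++ [ x ])
    rotated = record
      { distinct  = Unique-resp-↭ (↭-sym rotated↭) (unique C)
      ; linked    = Linked-rotate A x (subst (Linked (Adj G)) eq (path C))
                      (subst (λ zs → MaybeConnected (Adj G) (last zs) (head zs)) eq (Cycle-closed C))
      ; endpoints = Endpoints-resp {y ∷ [ x ]} {y ∷ D ++ A ++ [ x ]} refl (last-++ (y ∷ D) {A ++ [ x ]} (last-++-∷ A)) ends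
      }

  Cycle⇒ABPath : (C : Cycle G) → ContainsEdge C a b → Σ (List (Fin n)) λ P → IsABPath P × P ↭ verts C
  Cycle⇒ABPath C (inj₁ (inj₁ c))              = Cycle-rotate C c (inj₂ (refl , refl))
  Cycle⇒ABPath C (inj₁ (inj₂ (_ , eq , la))) = verts C , Cycle-asABPath C (inj₂ (cong head eq , la)) , refl
  Cycle⇒ABPath C (inj₂ (inj₁ c))              = Cycle-rotate C c (inj₁ (refl , refl))
  Cycle⇒ABPath C (inj₂ (inj₂ (_ , eq , lb))) = verts C , Cycle-asABPath C (inj₁ (cong head eq , lb)) , refl

  ABPath-insert : ∀ A {x y D w} → IsABPath (A ++ x ∷ y ∷ D) → w ∉ A ++ x ∷ y ∷ D →
                  Adj G x w → Adj G w y → IsABPath (A ++ x ∷ w ∷ y ∷ D)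
  ABPath-insert A {w = w} path w∉ xw wy = record
    { distinct  = Unique-resp-↭ (↭-sym (shift-after A w)) (¬Any⇒All¬ _ w∉ ∷ distinct path)
    ; linked    = Linked-replaceSuffix A (linked path) (xw ∷ wy ∷ Linked.tail (Linked-++⁻ʳ A (linked path)))
    ; endpoints = Endpoints-resp (head-++-∷ A) (trans (last-++-∷ A) (sym (last-++-∷ A))) (endpoints path)
    }

  -- x w u … y z v replaces x y … u v: the segment from y to u is traversed backwards.
  ABPath-reroute : ∀ A {x S v D y u w z} → IsABPath (A ++ x ∷ S ++ v ∷ D) → head S ≡ just y → last S ≡ just u →
                   w ∉ A ++ x ∷ S ++ v ∷ D → z ∉ A ++ x ∷ S ++ v ∷ D → w ≢ z →
                   Adj G x w → Adj G w u → Adj G y z → Adj G z v → IsABPath (A ++ x ∷ w ∷ S ʳ++ z ∷ v ∷ D)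
  ABPath-reroute A {x} {S} {v} {D} {w = w} {z} path headS lastS w∉ z∉ w≢z xw wu yz zv = record
    { distinct  = Unique-resp-↭ (↭-sym (reroute-↭ A w S z))
                    ((w≢z ∷ ¬Any⇒All¬ _ w∉) ∷ ¬Any⇒All¬ _ z∉ ∷ distinct path)
    ; linked    = Linked-replaceSuffix A (linked path) (xw ∷ (w~u ∷′ reversed))
    ; endpoints = Endpoints-resp (head-++-∷ A) last≡ (endpoints path)
    }
    where
    S⋯D : Linked (Adj G) (S ++ v ∷ D)
    S⋯D = Linked.tail (Linked-++⁻ʳ A (linked path))
    z~y = subst (MaybeConnected (Adj G) (just z)) (sym headS) (just (adj-sym G yz))
    reversed : Linked (Adj G) (S ʳ++ z ∷ v ∷ D)
    reversed = Linked-ʳ++⁺ (adj-sym G) S (z~y ∷′ Linked-++⁻ˡ S S⋯D) (zv ∷ Linked-++⁻ʳ S S⋯D)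
    w~u = subst (MaybeConnected (Adj G) (just w)) (sym (head-ʳ++ S lastS)) (just wu)
    last≡ : last (A ++ x ∷ w ∷ S ʳ++ z ∷ v ∷ D) ≡ last (A ++ x ∷ S ++ v ∷ D)
    last≡ = begin
      last (A ++ x ∷ w ∷ S ʳ++ z ∷ v ∷ D)  ≡⟨ last-++-∷ A ⟩
      last (w ∷ S ʳ++ z ∷ v ∷ D)            ≡⟨ last-∷-ʳ++ S ⟩
      last (v ∷ D)                          ≡⟨ last-++-∷ (x ∷ S) ⟨
      last (x ∷ S ++ v ∷ D)                 ≡⟨ last-++-∷ A ⟨
      last (A ++ x ∷ S ++ v ∷ D)            ∎
      where open ≡-Reasoning

  longer⇒¬Longest : ∀ {P Q} → LongestABPath P → IsABPath Q → length P < length Q → ⊥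
  longer⇒¬Longest (_ , longest) Q-path P<Q = <⇒≱ P<Q (longest Q-path)

  Longest-¬insert : ∀ {P} → LongestABPath P → ∀ A {x y D w} → P ≡ A ++ x ∷ y ∷ D → w ∉ P →
                    Adj G x w → Adj G w y → ⊥
  Longest-¬insert longest A {w = w} refl w∉ xw wy =
    longer⇒¬Longest longest (ABPath-insert A (proj₁ longest) w∉ xw wy)
      (≤-reflexive (sym (↭-length (shift-after A w))))

  Longest-¬reroute : ∀ {P} → LongestABPath P → ∀ A {x S v D y u w z} → P ≡ A ++ x ∷ S ++ v ∷ D →
                     head S ≡ just y → last S ≡ just u → w ∉ P → z ∉ P → w ≢ z →
                     Adj G x w → Adj G w u → Adj G y z → Adj G z v → ⊥
  Longest-¬reroute longest A {S = S} {w = w} {z} refl headS lastS w∉ z∉ w≢z xw wu yz zv =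
    longer⇒¬Longest longest (ABPath-reroute A (proj₁ longest) headS lastS w∉ z∉ w≢z xw wu yz zv)
      (≤-trans (n≤1+n _) (≤-reflexive (sym (↭-length (reroute-↭ A w S z)))))

  Longest⇒pairBound : ∀ {P} → LongestABPath P → All (OutsideNeighbour G P) P →
                      pred (length P) ≤ length (outside P) * pred (length (outside P))
  Longest⇒pairBound {P} longest out =
    consecutiveImages-bound _≟_ g P (outside P) (λ x∈ → ∈-outside⁺ (g∉ x∈)) adjacent-distinct pairs-distinct
    where
    choice = All-choice out
    g = proj₁ choice
    g-adj : ∀ {x} → x ∈ P → Adj G x (g x)
    g-adj x∈ = proj₁ (proj₂ choice x∈)
    g∉ : ∀ {x} → x ∈ P → g x ∉ P
    g∉ x∈ = proj₂ (proj₂ choice x∈)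
    adjacent-distinct : ∀ zs x y ws → P ≡ zs ++ x ∷ y ∷ ws → g x ≢ g y
    adjacent-distinct zs x y ws eq gx≡gy =
      Longest-¬insert longest zs eq (g∉ x∈) (g-adj x∈) (subst (λ w → Adj G w y) (sym gx≡gy) (adj-sym G (g-adj y∈)))
      where
      x∈ = subst (x ∈_) (sym eq) (∈-++⁺ʳ zs (here refl))
      y∈ = subst (y ∈_) (sym eq) (∈-++⁺ʳ zs (there (here refl)))
    pairs-distinct : ∀ zs x S v ws {y u} → P ≡ zs ++ x ∷ S ++ v ∷ ws → head S ≡ just y → last S ≡ just u →
                     (g x , g y) ≢ (g u , g v)
    pairs-distinct zs x (y ∷ S) v ws eq refl lastS pair≡ =
      Longest-¬reroute longest zs eq refl lastS (g∉ x∈) (g∉ y∈) (adjacent-distinct zs x y (S ++ v ∷ ws) eq)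
        (g-adj x∈) (subst (λ w → Adj G w _) (sym (cong proj₁ pair≡)) (adj-sym G (g-adj u∈)))
        (g-adj y∈) (subst (λ w → Adj G w v) (sym (cong proj₂ pair≡)) (adj-sym G (g-adj v∈)))
      where
      inP : ∀ {q} → q ∈ zs ++ x ∷ y ∷ S ++ v ∷ ws → q ∈ P
      inP = subst (_ ∈_) (sym eq)
      x∈ = inP (∈-++⁺ʳ zs (here refl))
      y∈ = inP (∈-++⁺ʳ zs (there (here refl)))
      u∈ = inP (∈-++⁺ʳ zs (there (∈-++⁺ˡ {ys = v ∷ ws} (last⇒∈ {xs = y ∷ S} lastS))))
      v∈ = inP (∈-++⁺ʳ zs (there (∈-++⁺ʳ (y ∷ S) (here refl))))

module _ {n : ℕ} {G : SimpleGraph n} {a b : Fin n} (ab : Adj G a b) (C : Cycle G)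
         (longest : LongestCycleThrough a b C) where
  open ABPaths G a b

  ABPath-length≤ : ∀ {Q} → IsABPath Q → length Q ≤ cycleLength G C
  ABPath-length≤ {Q} Q-path with 3 ≤? length Q
  ... | yes 3≤ = let D , |D|≡|Q| , contains = ABPath⇒Cycle ab Q-path 3≤ in
                 subst (_≤ cycleLength G C) |D|≡|Q| (proj₂ longest D contains)
  ... | no 3≰ = ≤-trans (<⇒≤ (≰⇒> 3≰)) (long C)

  Cycle⇒LongestABPath : Σ (List (Fin n)) λ P → LongestABPath P × P ↭ verts C
  Cycle⇒LongestABPath with Cycle⇒ABPath C (proj₁ longest)
  ... | P , P-path , P↭C =
    P , (P-path , λ Q-path → ≤-trans (ABPath-length≤ Q-path) (≤-reflexive (↭-length (↭-sym P↭C)))) , P↭C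

  outsideNeighbours⇒¬LengthBound : All (OutsideNeighbour G (verts C)) (verts C) → ¬ LengthBound n (cycleLength G C)
  outsideNeighbours⇒¬LengthBound out with Cycle⇒LongestABPath
  ... | P , P-longest , P↭C =
    subst (λ L → ¬ LengthBound n L) (↭-length P↭C)
      (¬LengthBound 2≤|P| (length-outside (IsABPath.distinct (proj₁ P-longest))) (Longest⇒pairBound P-longest out-P))
    where
    out-P : All (OutsideNeighbour G P) P
    out-P = All-resp-↭ (↭-sym P↭C) (All.map (Product.map₂ (Product.map₂ (_∘ ∈-resp-↭ P↭C))) out)
    2≤|P| : 2 ≤ length P
    2≤|P| = ≤-trans (n≤1+n 2) (subst (3 ≤_) (sym (↭-length P↭C)) (long C))

theorem2p4 : (n : ℕ) (G : SimpleGraph n) → Connected G →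
    (∀ v → 3 ≤ degree G v) →
    (a b : Fin n) → Adj G a b →
    (C : Cycle G) → LongestCycleThrough a b C →
    LengthBound n (cycleLength G C) →
    HasChord C
theorem2p4 n G _ deg a b ab C longest bound with Chords.chordOrOutsideNeighbours C deg
... | inj₁ chord = chord
... | inj₂ out   = ⊥-elim (outsideNeighbours⇒¬LengthBound ab C longest out bound)
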